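{- Let $N$ be a positive integer and, for non-negative integers $n\le m\le N$, let $C_N(n,m)=\binom{m}{n}\big/\binom{N}{n}$. Then for non-negative integers $n,m$ with $n\le m\le N$: \[ \frac1n\, C_N(n,m)=\sum_{n\le b\le m}C_N(n,b)\,\frac1b\qquad\text{if } n>0, \] and \[ \sum_{n<a\le m}\frac1a\, C_N(a,m)=\sum_{n\le b<m}C_N(n,b)\,\frac{1}{N-b}\qquad\text{if } n<m, \] where $a,b$ range over integers. -}

module Defs where

open import Data.Nat using (ℕ; zero; suc; _∸_)
open import Data.Nat.Combinatorics using (_C_)
open import Data.Integer using (+_)
open import Data.Rational using (ℚ; 0ℚ; _*_; _/_)
import Data.Rational
open import Data.List using (List; map; foldr; applyUpTo)

-- Reciprocal of a natural number as a rational, with the (never used)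
-- convention inv 0 = 0. In the theorem it is only applied to positive numbers.
inv : ℕ → ℚ
inv zero    = 0ℚ
inv (suc k) = (+ 1) / suc k

toℚ : ℕ → ℚ
toℚ k = (+ k) / 1

CN : ℕ → ℕ → ℕ → ℚ
CN N n m = toℚ (m C n) * inv (N C n)

-- sumRange lo hi f = Σ_{lo ≤ i < hi} f i  (half-open range)
sumRange : ℕ → ℕ → (ℕ → ℚ) → ℚ
sumRange lo hi f = foldr Data.Rational._+_ 0ℚ (applyUpTo (λ i → f (lo Data.Nat.+ i)) (hi ∸ lo))

-- Clearing denominators, everything reduces to Pascal's rule and to
-- (k+1)·C(n,k+1) = (n−k)·C(n,k), which gives the absorption identity
-- n·C(m+1,n) = (m+1)·C(m,n−1). The first identity is proved by induction
-- on m: by absorption, going from m to m+1 adds C_N(n,m+1)/(m+1) to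
-- C_N(n,m)/n. The second is proved by downward induction on n. The left
-- side loses its first term C_N(n+1,m)/(n+1). The right side loses the same
-- amount, because C_N(n,b)/(N−b) − C_N(n+1,b)/(N−b) = C_N(n,b)/(N−n), and
-- the hockey-stick identity sums this over n ≤ b < m to C_N(n+1,m)/(n+1).

module Submission where

open import Defs
open import Data.Nat using (ℕ; suc; _≤_; _<_; _∸_)
open import Data.Product using (_×_)
open import Relation.Binary.PropositionalEquality using (_≡_)

open import Data.Nat as ℕ
  using (zero; NonZero; z≤n; s≤s; z<s; _≤′_; ≤′-refl; ≤′-step; _≤‴_; ≤‴-refl; ≤‴-step)
import Data.Nat.Properties as ℕ
open import Data.Nat.Combinatorics
  using (_C_; nCk≡nC[n∸k]; nCn≡1; nC1≡n; nCk+nC[k+1]≡[n+1]C[k+1]; k>n⇒nCk≡0)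
open import Relation.Binary.PropositionalEquality
  using (refl; sym; trans; cong; cong₂; subst; module ≡-Reasoning)

module Binomial where
  open import Data.Nat using (_+_; _*_)
  open import Data.Nat.Properties
  open import Data.Nat.Solver using (module +-*-Solver)

  nC0≡1 : ∀ n → n C 0 ≡ 1
  nC0≡1 n = trans (nCk≡nC[n∸k] {n = n} z≤n) (nCn≡1 n)

  k≤n⇒0<nCk : ∀ {n k} → k ≤ n → 0 < n C k
  k≤n⇒0<nCk {n}     {zero}  _         = subst (0 <_) (sym (nC0≡1 n)) z<s
  k≤n⇒0<nCk {suc n} {suc k} (s≤s k≤n) =
    <-≤-trans (k≤n⇒0<nCk k≤n) (subst (n C k ≤_) (nCk+nC[k+1]≡[n+1]C[k+1] n k) (m≤m+n _ _))

  [k+1]*nC[k+1]+k*nCk≡n*nCk : ∀ n k → suc k * (n C suc k) + k * (n C k) ≡ n * (n C k)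
  [k+1]*nC[k+1]+k*nCk≡n*nCk zero    zero    = refl
  [k+1]*nC[k+1]+k*nCk≡n*nCk zero    (suc k) = cong₂ _+_ (*-zeroʳ (2 + k)) (*-zeroʳ (suc k))
  [k+1]*nC[k+1]+k*nCk≡n*nCk (suc n) zero    = begin
    1 * (suc n C 1) + 0    ≡⟨ trans (+-identityʳ _) (*-identityˡ _) ⟩
    suc n C 1              ≡⟨ nC1≡n (suc n) ⟩
    suc n                  ≡⟨ *-identityʳ (suc n) ⟨
    suc n * 1              ≡⟨ cong (suc n *_) (nC0≡1 (suc n)) ⟨
    suc n * (suc n C 0)    ∎
    where open ≡-Reasoning
  [k+1]*nC[k+1]+k*nCk≡n*nCk (suc n) (suc k) = begin
    (2 + k) * (suc n C (2 + k)) + suc k * (suc n C suc k)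
      ≡⟨ cong₂ (λ x y → (2 + k) * x + suc k * y)
               (nCk+nC[k+1]≡[n+1]C[k+1] n (suc k)) (nCk+nC[k+1]≡[n+1]C[k+1] n k) ⟨
    (2 + k) * (b₁ + b₂) + suc k * (b₀ + b₁)
      ≡⟨ solve 4 (λ k b₀ b₁ b₂ → (con 2 :+ k) :* (b₁ :+ b₂) :+ (con 1 :+ k) :* (b₀ :+ b₁)
                   := ((con 2 :+ k) :* b₂ :+ (con 1 :+ k) :* b₁) :+ (b₀ :+ b₁) :+ ((con 1 :+ k) :* b₁ :+ k :* b₀))
               refl k b₀ b₁ b₂ ⟩
    ((2 + k) * b₂ + suc k * b₁) + (b₀ + b₁) + (suc k * b₁ + k * b₀)
      ≡⟨ cong₂ (λ x y → x + (b₀ + b₁) + y)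
               ([k+1]*nC[k+1]+k*nCk≡n*nCk n (suc k)) ([k+1]*nC[k+1]+k*nCk≡n*nCk n k) ⟩
    n * b₁ + (b₀ + b₁) + n * b₀
      ≡⟨ solve 3 (λ n b₀ b₁ → n :* b₁ :+ (b₀ :+ b₁) :+ n :* b₀ := (con 1 :+ n) :* (b₀ :+ b₁)) refl n b₀ b₁ ⟩
    suc n * (b₀ + b₁)
      ≡⟨ cong (suc n *_) (nCk+nC[k+1]≡[n+1]C[k+1] n k) ⟩
    suc n * (suc n C suc k)
      ∎
    where
    open ≡-Reasoning
    open +-*-Solver
    b₀ b₁ b₂ : ℕ
    b₀ = n C k
    b₁ = n C suc k
    b₂ = n C (2 + k)

  [k+1]*nC[k+1]≡[n∸k]*nCk : ∀ {n k} → k ≤ n → suc k * (n C suc k) ≡ (n ∸ k) * (n C k)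
  [k+1]*nC[k+1]≡[n∸k]*nCk {n} {k} k≤n = +-cancelʳ-≡ (k * (n C k)) _ _ (begin
    suc k * (n C suc k) + k * (n C k)  ≡⟨ [k+1]*nC[k+1]+k*nCk≡n*nCk n k ⟩
    n * (n C k)                        ≡⟨ cong (_* (n C k)) (m∸n+n≡m k≤n) ⟨
    (n ∸ k + k) * (n C k)              ≡⟨ *-distribʳ-+ (n C k) (n ∸ k) k ⟩
    (n ∸ k) * (n C k) + k * (n C k)    ∎)
    where open ≡-Reasoning

  [k+1]*[n+1]C[k+1]≡[n+1]*nCk : ∀ n k → suc k * (suc n C suc k) ≡ suc n * (n C k)
  [k+1]*[n+1]C[k+1]≡[n+1]*nCk n k = begin
    suc k * (suc n C suc k)
      ≡⟨ cong (suc k *_) (nCk+nC[k+1]≡[n+1]C[k+1] n k) ⟨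
    suc k * (n C k + n C suc k)
      ≡⟨ solve 3 (λ k b₀ b₁ → (con 1 :+ k) :* (b₀ :+ b₁) := b₀ :+ ((con 1 :+ k) :* b₁ :+ k :* b₀))
               refl k (n C k) (n C suc k) ⟩
    n C k + (suc k * (n C suc k) + k * (n C k))
      ≡⟨ cong (n C k +_) ([k+1]*nC[k+1]+k*nCk≡n*nCk n k) ⟩
    n C k + n * (n C k)
      ∎
    where
    open ≡-Reasoning
    open +-*-Solver

  nC[k+1]*[N∸k]*NCk≡nCk*[n∸k]*NC[k+1] : ∀ {N n k} → k ≤ n → k ≤ N →
    (n C suc k) * (N ∸ k) * (N C k) ≡ (n C k) * (n ∸ k) * (N C suc k)
  nC[k+1]*[N∸k]*NCk≡nCk*[n∸k]*NC[k+1] {N} {n} {k} k≤n k≤N = *-cancelˡ-≡ _ _ (suc k) (begin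
    suc k * (Y * u * P)  ≡⟨ solve 4 (λ s y u p → s :* (y :* u :* p) := (s :* y) :* (u :* p)) refl (suc k) Y u P ⟩
    suc k * Y * (u * P)  ≡⟨ cong (_* (u * P)) ([k+1]*nC[k+1]≡[n∸k]*nCk k≤n) ⟩
    d * X * (u * P)      ≡⟨ cong (d * X *_) ([k+1]*nC[k+1]≡[n∸k]*nCk k≤N) ⟨
    d * X * (suc k * Q)  ≡⟨ solve 4 (λ s x d q → d :* x :* (s :* q) := s :* (x :* d :* q)) refl (suc k) X d Q ⟩
    suc k * (X * d * Q)  ∎)
    where
    open ≡-Reasoning
    open +-*-Solver
    X Y P Q u d : ℕ
    X = n C k
    Y = n C suc k
    P = N C k
    Q = N C suc k
    u = N ∸ k
    d = n ∸ k

open Binomial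

open import Data.Rational using (_*_)
import Data.Integer as ℤ
import Data.Integer.Properties as ℤ
open import Data.Rational as ℚ using (ℚ; 0ℚ; 1ℚ; toℚᵘ; _+_)
import Data.Rational.Properties as ℚ
open import Data.Rational.Solver using (module +-*-Solver)
open import Data.Rational.Unnormalised as ℚᵘ using (mkℚᵘ; _≃_; *≡*)
import Data.Rational.Unnormalised.Properties as ℚᵘ
open import Data.List using (foldr; applyUpTo)
open import Data.Product using (_,_)

private
  toℚᵘ-toℚ : ∀ a → toℚᵘ (toℚ a) ≃ mkℚᵘ (ℤ.+ a) 0
  toℚᵘ-toℚ a = ℚ.toℚᵘ-fromℚᵘ (mkℚᵘ (ℤ.+ a) 0)

  toℚᵘ-inv : ∀ a .{{_ : NonZero a}} → toℚᵘ (inv a) ≃ mkℚᵘ (ℤ.+ 1) (ℕ.pred a)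
  toℚᵘ-inv (suc a) = ℚ.toℚᵘ-fromℚᵘ (mkℚᵘ (ℤ.+ 1) a)

toℚ-+ : ∀ a b → toℚ (a ℕ.+ b) ≡ toℚ a + toℚ b
toℚ-+ a b = ℚ.toℚᵘ-injective (begin
  toℚᵘ (toℚ (a ℕ.+ b))                    ≈⟨ toℚᵘ-toℚ (a ℕ.+ b) ⟩
  mkℚᵘ (ℤ.+ (a ℕ.+ b)) 0                  ≈⟨ *≡* (cong (ℤ._* ℤ.+ 1) (trans (ℤ.pos-+ a b)
                                               (sym (cong₂ ℤ._+_ (ℤ.*-identityʳ (ℤ.+ a)) (ℤ.*-identityʳ (ℤ.+ b)))))) ⟩
  mkℚᵘ (ℤ.+ a) 0 ℚᵘ.+ mkℚᵘ (ℤ.+ b) 0      ≈⟨ ℚᵘ.+-cong (toℚᵘ-toℚ a) (toℚᵘ-toℚ b) ⟨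
  toℚᵘ (toℚ a) ℚᵘ.+ toℚᵘ (toℚ b)          ≈⟨ ℚ.toℚᵘ-homo-+ (toℚ a) (toℚ b) ⟨
  toℚᵘ (toℚ a + toℚ b)                    ∎)
  where open ℚᵘ.≃-Reasoning

toℚ-* : ∀ a b → toℚ (a ℕ.* b) ≡ toℚ a * toℚ b
toℚ-* a b = ℚ.toℚᵘ-injective (begin
  toℚᵘ (toℚ (a ℕ.* b))                    ≈⟨ toℚᵘ-toℚ (a ℕ.* b) ⟩
  mkℚᵘ (ℤ.+ (a ℕ.* b)) 0                  ≈⟨ *≡* (cong (ℤ._* ℤ.+ 1) (ℤ.pos-* a b)) ⟩
  mkℚᵘ (ℤ.+ a) 0 ℚᵘ.* mkℚᵘ (ℤ.+ b) 0      ≈⟨ ℚᵘ.*-cong (toℚᵘ-toℚ a) (toℚᵘ-toℚ b) ⟨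
  toℚᵘ (toℚ a) ℚᵘ.* toℚᵘ (toℚ b)          ≈⟨ ℚ.toℚᵘ-homo-* (toℚ a) (toℚ b) ⟨
  toℚᵘ (toℚ a * toℚ b)                    ∎)
  where open ℚᵘ.≃-Reasoning

toℚ*inv≡1 : ∀ a .{{_ : NonZero a}} → toℚ a * inv a ≡ 1ℚ
toℚ*inv≡1 (suc a) = ℚ.toℚᵘ-injective (begin
  toℚᵘ (toℚ (suc a) * inv (suc a))            ≈⟨ ℚ.toℚᵘ-homo-* (toℚ (suc a)) (inv (suc a)) ⟩
  toℚᵘ (toℚ (suc a)) ℚᵘ.* toℚᵘ (inv (suc a))  ≈⟨ ℚᵘ.*-cong (toℚᵘ-toℚ (suc a)) (toℚᵘ-inv (suc a)) ⟩
  mkℚᵘ (ℤ.+ suc a) 0 ℚᵘ.* mkℚᵘ (ℤ.+ 1) a      ≈⟨ *≡* (cong (λ z → ℤ.+ suc z) (trans (ℕ.*-identityʳ _)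
                                                   (trans (ℕ.*-identityʳ a) (sym (trans (ℕ.+-identityʳ _) (ℕ.+-identityʳ a)))))) ⟩
  ℚᵘ.1ℚᵘ                                      ∎)
  where open ℚᵘ.≃-Reasoning

inv-* : ∀ a b .{{_ : NonZero a}} .{{_ : NonZero b}} → inv (a ℕ.* b) ≡ inv a * inv b
inv-* (suc a) (suc b) = ℚ.toℚᵘ-injective (begin
  toℚᵘ (inv (suc a ℕ.* suc b))                ≈⟨ toℚᵘ-inv (suc a ℕ.* suc b) ⟩
  mkℚᵘ (ℤ.+ 1) (b ℕ.+ a ℕ.* suc b)            ≈⟨ *≡* refl ⟩
  mkℚᵘ (ℤ.+ 1) a ℚᵘ.* mkℚᵘ (ℤ.+ 1) b          ≈⟨ ℚᵘ.*-cong (toℚᵘ-inv (suc a)) (toℚᵘ-inv (suc b)) ⟨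
  toℚᵘ (inv (suc a)) ℚᵘ.* toℚᵘ (inv (suc b))  ≈⟨ ℚ.toℚᵘ-homo-* (inv (suc a)) (inv (suc b)) ⟨
  toℚᵘ (inv (suc a) * inv (suc b))            ∎)
  where open ℚᵘ.≃-Reasoning

toℚ*inv-identityʳ : ∀ a .{{_ : NonZero a}} x → x * (toℚ a * inv a) ≡ x
toℚ*inv-identityʳ a x = trans (cong (x *_) (toℚ*inv≡1 a)) (ℚ.*-identityʳ x)

toℚ*inv-cross : ∀ {x a y b} .{{_ : NonZero a}} .{{_ : NonZero b}} →
                x ℕ.* b ≡ y ℕ.* a → toℚ x * inv a ≡ toℚ y * inv b
toℚ*inv-cross {x} {a} {y} {b} xb≡ya = begin
  toℚ x * inv a
    ≡⟨ toℚ*inv-identityʳ b (toℚ x * inv a) ⟨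
  toℚ x * inv a * (toℚ b * inv b)
    ≡⟨ solve 4 (λ x a⁻¹ b b⁻¹ → x :* a⁻¹ :* (b :* b⁻¹) := x :* b :* a⁻¹ :* b⁻¹) refl (toℚ x) (inv a) (toℚ b) (inv b) ⟩
  toℚ x * toℚ b * inv a * inv b
    ≡⟨ cong (λ z → z * inv a * inv b) (trans (sym (toℚ-* x b)) (trans (cong toℚ xb≡ya) (toℚ-* y a))) ⟩
  toℚ y * toℚ a * inv a * inv b
    ≡⟨ solve 4 (λ y a a⁻¹ b⁻¹ → y :* a :* a⁻¹ :* b⁻¹ := y :* b⁻¹ :* (a :* a⁻¹)) refl (toℚ y) (toℚ a) (inv a) (inv b) ⟩
  toℚ y * inv b * (toℚ a * inv a)
    ≡⟨ toℚ*inv-identityʳ a (toℚ y * inv b) ⟩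
  toℚ y * inv b
    ∎
  where
  open ≡-Reasoning
  open +-*-Solver

private
  sumUpTo : ℕ → (ℕ → ℚ) → ℚ
  sumUpTo k f = foldr _+_ 0ℚ (applyUpTo f k)

  sumUpTo-snoc : ∀ k f → sumUpTo (suc k) f ≡ sumUpTo k f + f k
  sumUpTo-snoc zero    f = trans (ℚ.+-identityʳ (f 0)) (sym (ℚ.+-identityˡ (f 0)))
  sumUpTo-snoc (suc k) f = trans (cong (f 0 +_) (sumUpTo-snoc k (λ i → f (suc i))))
                                 (sym (ℚ.+-assoc (f 0) _ _))

  sumUpTo-cong : ∀ k {f g} → (∀ i → i < k → f i ≡ g i) → sumUpTo k f ≡ sumUpTo k g
  sumUpTo-cong zero    f≗g = refl
  sumUpTo-cong (suc k) f≗g =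
    cong₂ _+_ (f≗g 0 z<s) (sumUpTo-cong k (λ i i<k → f≗g (suc i) (s≤s i<k)))

  sumUpTo-+ : ∀ k f g → sumUpTo k (λ i → f i + g i) ≡ sumUpTo k f + sumUpTo k g
  sumUpTo-+ zero    f g = sym (ℚ.+-identityʳ 0ℚ)
  sumUpTo-+ (suc k) f g = begin
    (f 0 + g 0) + sumUpTo k (λ i → f′ i + g′ i)
      ≡⟨ cong ((f 0 + g 0) +_) (sumUpTo-+ k f′ g′) ⟩
    (f 0 + g 0) + (sumUpTo k f′ + sumUpTo k g′)
      ≡⟨ solve 4 (λ a b s t → (a :+ b) :+ (s :+ t) := (a :+ s) :+ (b :+ t)) refl (f 0) (g 0) (sumUpTo k f′) (sumUpTo k g′) ⟩
    (f 0 + sumUpTo k f′) + (g 0 + sumUpTo k g′)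
      ∎
    where
    open ≡-Reasoning
    open +-*-Solver
    f′ g′ : ℕ → ℚ
    f′ i = f (suc i)
    g′ i = g (suc i)

  sumUpTo-*ʳ : ∀ k f x → sumUpTo k (λ i → f i * x) ≡ sumUpTo k f * x
  sumUpTo-*ʳ zero    f x = sym (ℚ.*-zeroˡ x)
  sumUpTo-*ʳ (suc k) f x = trans (cong (f 0 * x +_) (sumUpTo-*ʳ k (λ i → f (suc i)) x))
                                 (sym (ℚ.*-distribʳ-+ x (f 0) _))

m<n∸o⇒o+m<n : ∀ {m} n o → m < n ∸ o → o ℕ.+ m < n
m<n∸o⇒o+m<n n       zero    m<n   = m<n
m<n∸o⇒o+m<n (suc n) (suc o) m<n∸o = s≤s (m<n∸o⇒o+m<n n o m<n∸o)

sumRange-empty : ∀ n f → sumRange n n f ≡ 0ℚ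
sumRange-empty n f = cong (λ k → sumUpTo k (λ i → f (n ℕ.+ i))) (ℕ.n∸n≡0 n)

sumRange-snoc : ∀ lo hi f → lo ≤ hi → sumRange lo (suc hi) f ≡ sumRange lo hi f + f hi
sumRange-snoc lo hi f lo≤hi = begin
  sumUpTo (suc hi ∸ lo) (λ i → f (lo ℕ.+ i))    ≡⟨ cong (λ k → sumUpTo k (λ i → f (lo ℕ.+ i))) (ℕ.+-∸-assoc 1 lo≤hi) ⟩
  sumUpTo (suc (hi ∸ lo)) (λ i → f (lo ℕ.+ i))  ≡⟨ sumUpTo-snoc (hi ∸ lo) (λ i → f (lo ℕ.+ i)) ⟩
  sumRange lo hi f + f (lo ℕ.+ (hi ∸ lo))       ≡⟨ cong (λ i → sumRange lo hi f + f i) (ℕ.m+[n∸m]≡n lo≤hi) ⟩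
  sumRange lo hi f + f hi                       ∎
  where open ≡-Reasoning

sumRange-singleton : ∀ n f → sumRange n (suc n) f ≡ f n
sumRange-singleton n f = begin
  sumRange n (suc n) f  ≡⟨ sumRange-snoc n n f ℕ.≤-refl ⟩
  sumRange n n f + f n  ≡⟨ cong (_+ f n) (sumRange-empty n f) ⟩
  0ℚ + f n              ≡⟨ ℚ.+-identityˡ (f n) ⟩
  f n                   ∎
  where open ≡-Reasoning

sumRange-cons : ∀ lo hi f → lo < hi → sumRange lo hi f ≡ f lo + sumRange (suc lo) hi f
sumRange-cons lo hi f lo<hi = begin
  sumUpTo (hi ∸ lo) (λ i → f (lo ℕ.+ i))
    ≡⟨ cong (λ k → sumUpTo k (λ i → f (lo ℕ.+ i))) (ℕ.+-∸-assoc 1 lo<hi) ⟩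
  f (lo ℕ.+ 0) + sumUpTo (hi ∸ suc lo) (λ i → f (lo ℕ.+ suc i))
    ≡⟨ cong₂ _+_ (cong f (ℕ.+-identityʳ lo)) (sumUpTo-cong (hi ∸ suc lo) (λ i _ → cong f (ℕ.+-suc lo i))) ⟩
  f lo + sumRange (suc lo) hi f
    ∎
  where open ≡-Reasoning

sumRange-cong : ∀ lo hi {f g} → (∀ i → lo ≤ i → i < hi → f i ≡ g i) → sumRange lo hi f ≡ sumRange lo hi g
sumRange-cong lo hi f≗g =
  sumUpTo-cong (hi ∸ lo) (λ i i<hi∸lo → f≗g (lo ℕ.+ i) (ℕ.m≤m+n lo i) (m<n∸o⇒o+m<n hi lo i<hi∸lo))

sumRange-+ : ∀ lo hi f g → sumRange lo hi (λ i → f i + g i) ≡ sumRange lo hi f + sumRange lo hi g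
sumRange-+ lo hi f g = sumUpTo-+ (hi ∸ lo) (λ i → f (lo ℕ.+ i)) (λ i → g (lo ℕ.+ i))

sumRange-*ʳ : ∀ lo hi f x → sumRange lo hi (λ i → f i * x) ≡ sumRange lo hi f * x
sumRange-*ʳ lo hi f x = sumUpTo-*ʳ (hi ∸ lo) (λ i → f (lo ℕ.+ i)) x

hockey-stick : ∀ {n m} → n ≤′ m → sumRange n m (λ b → toℚ (b C n)) ≡ toℚ (m C suc n)
hockey-stick {n} ≤′-refl =
  trans (sumRange-empty n (λ b → toℚ (b C n))) (cong toℚ (sym (k>n⇒nCk≡0 (ℕ.n<1+n n))))
hockey-stick {n} (≤′-step {m} n≤′m) = begin
  sumRange n (suc m) f           ≡⟨ sumRange-snoc n m f (ℕ.≤′⇒≤ n≤′m) ⟩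
  sumRange n m f + toℚ (m C n)   ≡⟨ cong (_+ toℚ (m C n)) (hockey-stick n≤′m) ⟩
  toℚ (m C suc n) + toℚ (m C n)  ≡⟨ ℚ.+-comm (toℚ (m C suc n)) (toℚ (m C n)) ⟩
  toℚ (m C n) + toℚ (m C suc n)  ≡⟨ toℚ-+ (m C n) (m C suc n) ⟨
  toℚ (m C n ℕ.+ m C suc n)      ≡⟨ cong toℚ (nCk+nC[k+1]≡[n+1]C[k+1] m n) ⟩
  toℚ (suc m C suc n)            ∎
  where
  open ≡-Reasoning
  f : ℕ → ℚ
  f b = toℚ (b C n)

inv*CN-step : ∀ N k m →
  inv (suc k) * CN N (suc k) (suc m) ≡ inv (suc k) * CN N (suc k) m + CN N (suc k) (suc m) * inv (suc m)
inv*CN-step N k m = begin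
  inv n * (toℚ (suc m C n) * inv P)
    ≡⟨ cong (λ z → inv n * (toℚ z * inv P)) (nCk+nC[k+1]≡[n+1]C[k+1] m k) ⟨
  inv n * (toℚ (m C k ℕ.+ m C n) * inv P)
    ≡⟨ cong (λ z → inv n * (z * inv P)) (toℚ-+ (m C k) (m C n)) ⟩
  inv n * ((toℚ (m C k) + toℚ (m C n)) * inv P)
    ≡⟨ solve 4 (λ a b n⁻¹ P⁻¹ → n⁻¹ :* ((a :+ b) :* P⁻¹) := n⁻¹ :* (b :* P⁻¹) :+ a :* n⁻¹ :* P⁻¹)
             refl (toℚ (m C k)) (toℚ (m C n)) (inv n) (inv P) ⟩
  inv n * CN N n m + toℚ (m C k) * inv n * inv P
    ≡⟨ cong (λ z → inv n * CN N n m + z * inv P) absorption ⟩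
  inv n * CN N n m + toℚ (suc m C n) * inv (suc m) * inv P
    ≡⟨ solve 4 (λ c a m⁻¹ P⁻¹ → c :+ a :* m⁻¹ :* P⁻¹ := c :+ a :* P⁻¹ :* m⁻¹)
             refl (inv n * CN N n m) (toℚ (suc m C n)) (inv (suc m)) (inv P) ⟩
  inv n * CN N n m + CN N n (suc m) * inv (suc m)
    ∎
  where
  open ≡-Reasoning
  open +-*-Solver
  n P : ℕ
  n = suc k
  P = N C n
  absorption : toℚ (m C k) * inv n ≡ toℚ (suc m C n) * inv (suc m)
  absorption = toℚ*inv-cross {m C k} {n} {suc m C n} {suc m} (begin
    (m C k) ℕ.* suc m      ≡⟨ ℕ.*-comm (m C k) (suc m) ⟩
    suc m ℕ.* (m C k)      ≡⟨ [k+1]*[n+1]C[k+1]≡[n+1]*nCk m k ⟨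
    n ℕ.* (suc m C n)      ≡⟨ ℕ.*-comm n (suc m C n) ⟩
    (suc m C n) ℕ.* n      ∎)

inv*CN≡sum-CN*inv : ∀ N k {m} → suc k ≤′ m →
  inv (suc k) * CN N (suc k) m ≡ sumRange (suc k) (suc m) (λ b → CN N (suc k) b * inv b)
inv*CN≡sum-CN*inv N k ≤′-refl =
  trans (ℚ.*-comm (inv (suc k)) (CN N (suc k) (suc k)))
        (sym (sumRange-singleton (suc k) (λ b → CN N (suc k) b * inv b)))
inv*CN≡sum-CN*inv N k (≤′-step {m} n≤′m) = begin
  inv (suc k) * CN N (suc k) (suc m)        ≡⟨ inv*CN-step N k m ⟩
  inv (suc k) * CN N (suc k) m + f (suc m)  ≡⟨ cong (_+ f (suc m)) (inv*CN≡sum-CN*inv N k n≤′m) ⟩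
  sumRange (suc k) (suc m) f + f (suc m)    ≡⟨ sumRange-snoc (suc k) (suc m) f (ℕ.m≤n⇒m≤1+n (ℕ.≤′⇒≤ n≤′m)) ⟨
  sumRange (suc k) (suc (suc m)) f          ∎
  where
  open ≡-Reasoning
  f : ℕ → ℚ
  f b = CN N (suc k) b * inv b

CN[1+n]n≡0 : ∀ N n → CN N (suc n) n ≡ 0ℚ
CN[1+n]n≡0 N n =
  trans (cong (λ z → toℚ z * inv (N C suc n)) (k>n⇒nCk≡0 (ℕ.n<1+n n))) (ℚ.*-zeroˡ (inv (N C suc n)))

CN[n+1]*[N∸n]≡CN*[b∸n] : ∀ {N n b} → n ≤ b → n < N →
  CN N (suc n) b * toℚ (N ∸ n) ≡ CN N n b * toℚ (b ∸ n)
CN[n+1]*[N∸n]≡CN*[b∸n] {N} {n} {b} n≤b n<N = begin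
  toℚ Y * inv Q * toℚ u  ≡⟨ solve 3 (λ y q⁻¹ u → y :* q⁻¹ :* u := y :* u :* q⁻¹) refl (toℚ Y) (inv Q) (toℚ u) ⟩
  toℚ Y * toℚ u * inv Q  ≡⟨ cong (_* inv Q) (toℚ-* Y u) ⟨
  toℚ (Y ℕ.* u) * inv Q  ≡⟨ toℚ*inv-cross {Y ℕ.* u} {Q} {X ℕ.* d} {P}
                              (nC[k+1]*[N∸k]*NCk≡nCk*[n∸k]*NC[k+1] n≤b (ℕ.<⇒≤ n<N)) ⟩
  toℚ (X ℕ.* d) * inv P  ≡⟨ cong (_* inv P) (toℚ-* X d) ⟩
  toℚ X * toℚ d * inv P  ≡⟨ solve 3 (λ x d p⁻¹ → x :* d :* p⁻¹ := x :* p⁻¹ :* d) refl (toℚ X) (toℚ d) (inv P) ⟩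
  toℚ X * inv P * toℚ d  ∎
  where
  open ≡-Reasoning
  open +-*-Solver
  X Y P Q u d : ℕ
  X = b C n
  Y = b C suc n
  P = N C n
  Q = N C suc n
  u = N ∸ n
  d = b ∸ n
  instance
    P≢0 : NonZero P
    P≢0 = ℕ.>-nonZero (k≤n⇒0<nCk (ℕ.<⇒≤ n<N))
    Q≢0 : NonZero Q
    Q≢0 = ℕ.>-nonZero (k≤n⇒0<nCk n<N)

CN*inv-split : ∀ {N n b} → n ≤ b → b < N →
  CN N n b * inv (N ∸ b) ≡ CN N (suc n) b * inv (N ∸ b) + CN N n b * inv (N ∸ n)
CN*inv-split {N} {n} {b} n≤b b<N = sym (begin
  c′ * inv v + c * inv u
    ≡⟨ cong₂ _+_ (toℚ*inv-identityʳ u (c′ * inv v)) (toℚ*inv-identityʳ v (c * inv u)) ⟨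
  c′ * inv v * (toℚ u * inv u) + c * inv u * (toℚ v * inv v)
    ≡⟨ solve 6 (λ c′ c u v u⁻¹ v⁻¹ → c′ :* v⁻¹ :* (u :* u⁻¹) :+ c :* u⁻¹ :* (v :* v⁻¹)
                                    := (c′ :* u :+ c :* v) :* (u⁻¹ :* v⁻¹))
             refl c′ c (toℚ u) (toℚ v) (inv u) (inv v) ⟩
  (c′ * toℚ u + c * toℚ v) * (inv u * inv v)
    ≡⟨ cong (λ z → (z + c * toℚ v) * (inv u * inv v)) (CN[n+1]*[N∸n]≡CN*[b∸n] n≤b n<N) ⟩
  (c * toℚ d + c * toℚ v) * (inv u * inv v)
    ≡⟨ solve 5 (λ c d v u⁻¹ v⁻¹ → (c :* d :+ c :* v) :* (u⁻¹ :* v⁻¹) := c :* (d :+ v) :* u⁻¹ :* v⁻¹)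
             refl c (toℚ d) (toℚ v) (inv u) (inv v) ⟩
  c * (toℚ d + toℚ v) * inv u * inv v
    ≡⟨ cong (λ z → c * z * inv u * inv v) (trans (sym (toℚ-+ d v)) (cong toℚ d+v≡u)) ⟩
  c * toℚ u * inv u * inv v
    ≡⟨ solve 4 (λ c u u⁻¹ v⁻¹ → c :* u :* u⁻¹ :* v⁻¹ := c :* v⁻¹ :* (u :* u⁻¹)) refl c (toℚ u) (inv u) (inv v) ⟩
  c * inv v * (toℚ u * inv u)
    ≡⟨ toℚ*inv-identityʳ u (c * inv v) ⟩
  c * inv v
    ∎)
  where
  open ≡-Reasoning
  open +-*-Solver
  c c′ : ℚ
  c = CN N n b
  c′ = CN N (suc n) b
  u v d : ℕ
  u = N ∸ n
  v = N ∸ b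
  d = b ∸ n
  n<N : n < N
  n<N = ℕ.≤-<-trans n≤b b<N
  d+v≡u : d ℕ.+ v ≡ u
  d+v≡u = trans (ℕ.+-comm d v) (trans (sym (ℕ.+-∸-assoc v n≤b)) (cong (_∸ n) (ℕ.m∸n+n≡m (ℕ.<⇒≤ b<N))))
  instance
    u≢0 : NonZero u
    u≢0 = ℕ.>-nonZero (ℕ.m<n⇒0<n∸m n<N)
    v≢0 : NonZero v
    v≢0 = ℕ.>-nonZero (ℕ.m<n⇒0<n∸m b<N)

hockey-stick-CN : ∀ {N n m} → n < N → n ≤′ m →
  sumRange n m (λ b → CN N n b * inv (N ∸ n)) ≡ inv (suc n) * CN N (suc n) m
hockey-stick-CN {N} {n} {m} n<N n≤′m = begin
  sumRange n m (λ b → toℚ (b C n) * inv P * inv u)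
    ≡⟨ sumRange-*ʳ n m (λ b → toℚ (b C n) * inv P) (inv u) ⟩
  sumRange n m (λ b → toℚ (b C n) * inv P) * inv u
    ≡⟨ cong (_* inv u) (sumRange-*ʳ n m (λ b → toℚ (b C n)) (inv P)) ⟩
  sumRange n m (λ b → toℚ (b C n)) * inv P * inv u
    ≡⟨ cong (λ z → z * inv P * inv u) (hockey-stick n≤′m) ⟩
  toℚ (m C suc n) * inv P * inv u
    ≡⟨ ℚ.*-assoc (toℚ (m C suc n)) (inv P) (inv u) ⟩
  toℚ (m C suc n) * (inv P * inv u)
    ≡⟨ cong (toℚ (m C suc n) *_) inv[P]*inv[u]≡inv[n+1]*inv[Q] ⟩
  toℚ (m C suc n) * (inv (suc n) * inv Q)
    ≡⟨ solve 3 (λ x s⁻¹ q⁻¹ → x :* (s⁻¹ :* q⁻¹) := s⁻¹ :* (x :* q⁻¹)) refl (toℚ (m C suc n)) (inv (suc n)) (inv Q) ⟩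
  inv (suc n) * CN N (suc n) m
    ∎
  where
  open ≡-Reasoning
  open +-*-Solver
  P Q u : ℕ
  P = N C n
  Q = N C suc n
  u = N ∸ n
  instance
    P≢0 : NonZero P
    P≢0 = ℕ.>-nonZero (k≤n⇒0<nCk (ℕ.<⇒≤ n<N))
    Q≢0 : NonZero Q
    Q≢0 = ℕ.>-nonZero (k≤n⇒0<nCk n<N)
    u≢0 : NonZero u
    u≢0 = ℕ.>-nonZero (ℕ.m<n⇒0<n∸m n<N)
  inv[P]*inv[u]≡inv[n+1]*inv[Q] : inv P * inv u ≡ inv (suc n) * inv Q
  inv[P]*inv[u]≡inv[n+1]*inv[Q] = begin
    inv P * inv u        ≡⟨ ℚ.*-comm (inv P) (inv u) ⟩
    inv u * inv P        ≡⟨ inv-* u P ⟨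
    inv (u ℕ.* P)        ≡⟨ cong inv ([k+1]*nC[k+1]≡[n∸k]*nCk (ℕ.<⇒≤ n<N)) ⟨
    inv (suc n ℕ.* Q)    ≡⟨ inv-* (suc n) Q ⟩
    inv (suc n) * inv Q  ∎

sum-CN*inv[N∸b]-recurrence : ∀ {N n m} → n < m → m ≤ N →
  sumRange n m (λ b → CN N n b * inv (N ∸ b))
    ≡ inv (suc n) * CN N (suc n) m + sumRange (suc n) m (λ b → CN N (suc n) b * inv (N ∸ b))
sum-CN*inv[N∸b]-recurrence {N} {n} {m} n<m m≤N = begin
  sumRange n m (λ b → CN N n b * inv (N ∸ b))
    ≡⟨ sumRange-cong n m (λ b n≤b b<m → CN*inv-split n≤b (ℕ.<-≤-trans b<m m≤N)) ⟩
  sumRange n m (λ b → R b + CN N n b * inv (N ∸ n))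
    ≡⟨ sumRange-+ n m R (λ b → CN N n b * inv (N ∸ n)) ⟩
  sumRange n m R + sumRange n m (λ b → CN N n b * inv (N ∸ n))
    ≡⟨ cong₂ _+_ (sumRange-cons n m R n<m) (hockey-stick-CN (ℕ.<-≤-trans n<m m≤N) (ℕ.≤⇒≤′ (ℕ.<⇒≤ n<m))) ⟩
  (R n + sumRange (suc n) m R) + inv (suc n) * CN N (suc n) m
    ≡⟨ cong (λ z → (z * inv (N ∸ n) + sumRange (suc n) m R) + inv (suc n) * CN N (suc n) m) (CN[1+n]n≡0 N n) ⟩
  (0ℚ * inv (N ∸ n) + sumRange (suc n) m R) + inv (suc n) * CN N (suc n) m
    ≡⟨ solve 3 (λ x s t → (con 0ℚ :* x :+ s) :+ t := t :+ s)
             refl (inv (N ∸ n)) (sumRange (suc n) m R) (inv (suc n) * CN N (suc n) m) ⟩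
  inv (suc n) * CN N (suc n) m + sumRange (suc n) m R
    ∎
  where
  open ≡-Reasoning
  open +-*-Solver
  R : ℕ → ℚ
  R b = CN N (suc n) b * inv (N ∸ b)

sum-inv*CN≡sum-CN*inv : ∀ {N m} → m ≤ N → ∀ {n} → n ≤‴ m →
  sumRange (suc n) (suc m) (λ a → inv a * CN N a m) ≡ sumRange n m (λ b → CN N n b * inv (N ∸ b))
sum-inv*CN≡sum-CN*inv {N} {m} m≤N ≤‴-refl =
  trans (sumRange-empty (suc m) (λ a → inv a * CN N a m))
        (sym (sumRange-empty m (λ b → CN N m b * inv (N ∸ b))))
sum-inv*CN≡sum-CN*inv {N} {m} m≤N {n} (≤‴-step n<‴m) = begin
  sumRange (suc n) (suc m) L                    ≡⟨ sumRange-cons (suc n) (suc m) L (s≤s n<m) ⟩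
  L (suc n) + sumRange (suc (suc n)) (suc m) L  ≡⟨ cong (L (suc n) +_) (sum-inv*CN≡sum-CN*inv m≤N n<‴m) ⟩
  L (suc n) + sumRange (suc n) m R              ≡⟨ sum-CN*inv[N∸b]-recurrence n<m m≤N ⟨
  sumRange n m (λ b → CN N n b * inv (N ∸ b))   ∎
  where
  open ≡-Reasoning
  n<m : n < m
  n<m = ℕ.≤‴⇒≤ n<‴m
  L R : ℕ → ℚ
  L a = inv a * CN N a m
  R b = CN N (suc n) b * inv (N ∸ b)

lemma4p1 : (N : ℕ) → 1 ≤ N → (n m : ℕ) → n ≤ m → m ≤ N →
    (0 < n → inv n * CN N n m ≡ sumRange n (suc m) (λ b → CN N n b * inv b))
    × (n < m → sumRange (suc n) (suc m) (λ a → inv a * CN N a m) ≡ sumRange n m (λ b → CN N n b * inv (N ∸ b)))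
lemma4p1 N _ n m n≤m m≤N = first , second
  where
  first : 0 < n → inv n * CN N n m ≡ sumRange n (suc m) (λ b → CN N n b * inv b)
  first z<s = inv*CN≡sum-CN*inv N _ (ℕ.≤⇒≤′ n≤m)
  second : n < m → sumRange (suc n) (suc m) (λ a → inv a * CN N a m) ≡ sumRange n m (λ b → CN N n b * inv (N ∸ b))
  second _ = sum-inv*CN≡sum-CN*inv m≤N (ℕ.≤⇒≤‴ n≤m)
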